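{- Let $\alpha=(a_1,\dots,a_n)\in PP_n$ and let $M=\max_{j\in[n]}u_\alpha(j)$ (so $M\ge 0$). If $\alpha$ is in descending order, i.e. $a_1\ge a_2\ge\dots\ge a_n$, then $\alpha\in PF_{n,k}$ for every integer $k\ge 1$ with $k\ge M$.
   Context: $[n]=\{1,\dots,n\}$, $PP_n=[n]^n$ is the set of parking preferences. Cars $c_1,\dots,c_n$ arrive in order at a one-way street with spots $1,\dots,n$; car $c_i$ has preference $a_i$. Under the $k$-Naples parking rule ($k\ge1$), car $c_i$ drives to spot $a_i$ and parks there if free; otherwise it checks spots $a_i-1,\dots,a_i-k$ (only those $\ge1$) in this order and parks in the first free one; if none is free it drives forward and parks in the first free spot $j>a_i$, failing if there is none. $PF_{n,k}$ is the set of $\alpha\in PP_n$ for which all cars park. $|\alpha|_i=|\{j: a_j=i\}|$, and $u_\alpha(j)=\sum_{i=j}^n|\alpha|_i-(n-j+1)$ for $j\in[n]$. -}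

module Defs where

open import Data.Nat using (ℕ; zero; suc; _+_; _∸_; _≤_; _≤ᵇ_; _≡ᵇ_)
open import Data.Bool using (Bool; true; false; not; _∧_; if_then_else_)
open import Data.List using (List; []; _∷_; map; upTo; _++_; length; filterᵇ)
open import Data.Bool.ListAction using (any)
open import Data.Nat.ListAction using (sum)
open import Data.Vec as V using (Vec)
open import Data.Maybe using (Maybe; just; nothing; is-just)
open import Data.Integer using (ℤ; +_; _-_)

InPP : (n : ℕ) → Vec ℕ n → Set
InPP n α = ∀ i → 1 ≤ V.lookup α i × V.lookup α i ≤ n
  where open import Data.Product using (_×_)

isFree : List ℕ → ℕ → Bool
isFree occ j = not (any (λ o → o ≡ᵇ j) occ)

valid : ℕ → ℕ → Bool
valid n j = (1 ≤ᵇ j) ∧ (j ≤ᵇ n)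

firstFree : ℕ → List ℕ → List ℕ → Maybe ℕ
firstFree n occ [] = nothing
firstFree n occ (c ∷ cs) =
  if valid n c ∧ isFree occ c then just c else firstFree n occ cs

-- order in which a car with preference a inspects spots under the
-- k-Naples rule on a street with n spots:
--   a, then a-1, …, a-k (invalid ones, i.e. < 1, are skipped),
--   then a+1, a+2, …, n.
naplesCandidates : ℕ → ℕ → ℕ → List ℕ
naplesCandidates n k a =
  a ∷ (map (λ i → a ∸ suc i) (upTo k) ++ map (λ i → a + suc i) (upTo (n ∸ a)))

parkFrom : ℕ → ℕ → List ℕ → List ℕ → Maybe (List ℕ)
parkFrom n k occ [] = just occ
parkFrom n k occ (a ∷ as) with firstFree n occ (naplesCandidates n k a)
... | nothing = nothing
... | just s  = parkFrom n k (s ∷ occ) as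

IsNaplesPF : (n k : ℕ) → Vec ℕ n → Set
IsNaplesPF n k α = is-just (parkFrom n k [] (V.toList α)) ≡ true
  where open import Relation.Binary.PropositionalEquality using (_≡_)

mult : {n : ℕ} → Vec ℕ n → ℕ → ℕ
mult α i = length (filterᵇ (λ a → a ≡ᵇ i) (V.toList α))

u : (n : ℕ) → Vec ℕ n → ℕ → ℤ
u n α j = + sum (map (λ t → mult α (j + t)) (upTo (n + 1 ∸ j))) - + (n + 1 ∸ j)

-- Since the preferences arrive in descending order, when a car with
-- preference a arrives every parked car had preference ≥ a.  Hence the
-- parked cars together with this one number at most
-- #{i : a_i ≥ a} = u_α(a) + (n + 1 − a) ≤ k + n + 1 − a.  If the car could
-- not park, every spot y ≤ n with y ≥ a − k (and y ≥ 1) would be taken: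
-- that is all n spots, or n + k + 1 − a of them, and both exceed the number
-- of cars already parked.
module Submission where

open import Defs
open import Data.Nat using (ℕ; _≤_)
open import Data.Fin using (Fin)
open import Data.Vec using (Vec; lookup)
open import Data.Integer using (+_)
open import Data.Integer as ℤ using ()

open import Data.Bool using (true; false; not; _∧_; if_then_else_; T)
open import Data.Bool.Properties using (T-≡)
open import Data.Empty using (⊥-elim)
open import Data.Fin as Fin using (toℕ)
open import Data.Fin.Properties using (toℕ-injective; toℕ<n; injective⇒≤)
open import Data.List as List using (List; []; _∷_; map; upTo; length; filter; filterᵇ)
open import Data.List.Membership.Propositional using (_∈_)
open import Data.List.Membership.Propositional.Properties
  using (∈-map⁺; ∈-upTo⁺; ∈-++⁺ˡ; ∈-++⁺ʳ)
open import Data.List.Properties using (filter-accept; filter-reject; map-cong)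
open import Data.List.Relation.Unary.All as All using (All; []; _∷_)
open import Data.List.Relation.Unary.AllPairs using (AllPairs; []; _∷_)
open import Data.List.Relation.Unary.Any as Any using (here; there)
open import Data.List.Relation.Unary.Any.Properties using (any⁻; lookup-index)
open import Data.Maybe using (just; nothing; is-just)
open import Data.Nat using (zero; suc; _+_; _∸_; _⊔_; _<_; _≥_; z≤n; s≤s; z<s; _≡ᵇ_; _≤?_)
open import Data.Nat.ListAction using (sum)
open import Data.Nat.Properties
open import Algebra.Properties.CommutativeSemigroup +-commutativeSemigroup
  using (interchange)
open import Data.Product using (_,_; proj₁; proj₂; uncurry)
open import Data.Vec as Vec using (toList)
open import Data.Vec.Properties using (length-toList)
open import Data.Vec.Relation.Unary.All.Properties using (toList⁺; lookup⁻)
import Data.Integer.Properties as ℤP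
open import Function.Bundles using (Equivalence)
open import Function.Definitions using (Injective)
open import Relation.Binary using (tri<; tri≈; tri>)
open import Relation.Binary.PropositionalEquality
open import Relation.Nullary using (yes; no)

δ : ℕ → ℕ → ℕ
δ x y = if x ≡ᵇ y then 1 else 0

δ-refl : ∀ x → δ x x ≡ 1
δ-refl zero    = refl
δ-refl (suc x) = δ-refl x

multiplicity : List ℕ → ℕ → ℕ
multiplicity xs y = length (filterᵇ (λ x → x ≡ᵇ y) xs)

multiplicity-∷ : ∀ x xs y → multiplicity (x ∷ xs) y ≡ δ x y + multiplicity xs y
multiplicity-∷ x xs y with x ≡ᵇ y
... | true  = refl
... | false = refl

atLeast : ℕ → List ℕ → ℕ
atLeast b xs = length (filter (b ≤?_) xs)

atLeast-accept : ∀ {a b} xs → b ≤ a → atLeast b (a ∷ xs) ≡ suc (atLeast b xs)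
atLeast-accept {b = b} xs b≤a = cong length (filter-accept (b ≤?_) {xs = xs} b≤a)

∈⇒≤sum : ∀ {n ns} → n ∈ ns → n ≤ sum ns
∈⇒≤sum {ns = n ∷ ns} (here refl)  = m≤m+n n (sum ns)
∈⇒≤sum {ns = m ∷ ns} (there n∈ns) = ≤-trans (∈⇒≤sum n∈ns) (m≤n+m (sum ns) m)

sum-map-+ : ∀ {A : Set} (f g : A → ℕ) xs →
            sum (map (λ x → f x + g x) xs) ≡ sum (map f xs) + sum (map g xs)
sum-map-+ f g []       = refl
sum-map-+ f g (x ∷ xs) = trans (cong (_+_ (f x + g x)) (sum-map-+ f g xs))
                               (interchange (f x) (g x) (sum (map f xs)) (sum (map g xs)))

1≤sum-δ : ∀ {x lo m} → lo ≤ x → x < lo + m →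
          1 ≤ sum (map (λ t → δ x (lo + t)) (upTo m))
1≤sum-δ {x} {lo} {m} lo≤x x<lo+m =
  subst (_≤ sum (map (λ t → δ x (lo + t)) (upTo m)))
        (trans (cong (δ x) (m+[n∸m]≡n lo≤x)) (δ-refl x))
        (∈⇒≤sum (∈-map⁺ (λ t → δ x (lo + t)) (∈-upTo⁺ x∸lo<m)))
  where
  x∸lo<m : x ∸ lo < m
  x∸lo<m = subst (x ∸ lo <_) (m+n∸m≡n lo m) (∸-monoˡ-< x<lo+m lo≤x)

atLeast≤sum-multiplicity : ∀ lo m xs → All (_< lo + m) xs →
  atLeast lo xs ≤ sum (map (λ t → multiplicity xs (lo + t)) (upTo m))
atLeast≤sum-multiplicity lo m []       []                  = z≤n
atLeast≤sum-multiplicity lo m (x ∷ xs) (x<lo+m ∷ xs<lo+m) = begin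
  atLeast lo (x ∷ xs)       ≤⟨ count-x ⟩
  hits + sum (map others (upTo m))
    ≡⟨ sum-map-+ (λ t → δ x (lo + t)) others (upTo m) ⟨
  sum (map (λ t → δ x (lo + t) + others t) (upTo m))
    ≡⟨ cong sum (map-cong (λ t → sym (multiplicity-∷ x xs (lo + t))) (upTo m)) ⟩
  sum (map (λ t → multiplicity (x ∷ xs) (lo + t)) (upTo m)) ∎
  where
  open ≤-Reasoning
  others : ℕ → ℕ
  others t = multiplicity xs (lo + t)
  hits : ℕ
  hits = sum (map (λ t → δ x (lo + t)) (upTo m))
  ih : atLeast lo xs ≤ sum (map others (upTo m))
  ih = atLeast≤sum-multiplicity lo m xs xs<lo+m
  count-x : atLeast lo (x ∷ xs) ≤ hits + sum (map others (upTo m))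
  count-x with lo ≤? x
  ... | yes lo≤x = ≤-trans (≤-reflexive (atLeast-accept xs lo≤x))
                           (+-mono-≤ (1≤sum-δ lo≤x x<lo+m) ih)
  ... | no  lo≰x = ≤-trans (≤-reflexive (cong length (filter-reject (lo ≤?_) {xs = xs} lo≰x)))
                           (≤-trans ih (m≤n+m _ hits))

∈-injection⇒≤length : ∀ {A : Set} {m} {xs : List A} {f : Fin m → A} →
                      Injective _≡_ _≡_ f → (∀ i → f i ∈ xs) → m ≤ length xs
∈-injection⇒≤length {xs = xs} {f} f-injective f∈xs = injective⇒≤ index-injective
  where
  index-injective : Injective _≡_ _≡_ (λ i → Any.index (f∈xs i))
  index-injective {i} {j} same-index = f-injective (begin
    f i                               ≡⟨ lookup-index (f∈xs i) ⟩
    List.lookup xs (Any.index (f∈xs i)) ≡⟨ cong (List.lookup xs) same-index ⟩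
    List.lookup xs (Any.index (f∈xs j)) ≡⟨ lookup-index (f∈xs j) ⟨
    f j                               ∎)
    where open ≡-Reasoning

interval⊆⇒≤length : ∀ {xs : List ℕ} lo m → (∀ y → lo ≤ y → y < lo + m → y ∈ xs) →
                    m ≤ length xs
interval⊆⇒≤length lo m interval⊆xs =
  ∈-injection⇒≤length {f = λ i → lo + toℕ i}
    (λ {i} {j} eq → toℕ-injective (+-cancelˡ-≡ lo (toℕ i) (toℕ j) eq))
    (λ i → interval⊆xs (lo + toℕ i) (m≤m+n lo (toℕ i)) (+-monoʳ-< lo (toℕ<n i)))

isFree≡false⇒∈ : ∀ occ y → isFree occ y ≡ false → y ∈ occ
isFree≡false⇒∈ occ y taken =
  Any.map (λ o≡y → sym (≡ᵇ⇒≡ _ y o≡y)) (any⁻ (λ o → o ≡ᵇ y) occ (not-false taken))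
  where
  not-false : ∀ {b} → not b ≡ false → T b
  not-false {true} _ = _

valid-spot : ∀ {n y} → 1 ≤ y → y ≤ n → valid n y ≡ true
valid-spot {y = suc y} (s≤s z≤n) y≤n = Equivalence.to T-≡ (≤⇒≤ᵇ y≤n)

firstFree≡nothing⇒unavailable : ∀ {n occ c cs} → firstFree n occ cs ≡ nothing → c ∈ cs →
                                (valid n c ∧ isFree occ c) ≡ false
firstFree≡nothing⇒unavailable {n} {occ} {cs = d ∷ ds} none c∈cs
  with valid n d ∧ isFree occ d in available
firstFree≡nothing⇒unavailable () _ | true
firstFree≡nothing⇒unavailable _ (here refl)  | false = available
firstFree≡nothing⇒unavailable none (there c∈ds) | false =
  firstFree≡nothing⇒unavailable none c∈ds

∈-naplesCandidates : ∀ n k a {y} → y ≤ n → a ≤ y + k → y ∈ naplesCandidates n k a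
∈-naplesCandidates n k a {y} y≤n a≤y+k with <-cmp y a
... | tri≈ _ refl _ = here refl
... | tri< y<a _ _ with m≤n⇒∃[o]m+o≡n y<a
...   | d , refl = subst (_∈ naplesCandidates n k (suc y + d)) (m+n∸n≡m y d)
                     (there (∈-++⁺ˡ (∈-map⁺ (λ i → suc y + d ∸ suc i) (∈-upTo⁺ d<k))))
  where
  d<k : d < k
  d<k = +-cancelˡ-≤ y (suc d) k (subst (_≤ y + k) (sym (+-suc y d)) a≤y+k)
∈-naplesCandidates n k a {y} y≤n a≤y+k | tri> _ _ a<y with m≤n⇒∃[o]m+o≡n a<y
... | d , refl = subst (_∈ naplesCandidates n k a) (+-suc a d)
                   (there (∈-++⁺ʳ (map (λ i → a ∸ suc i) (upTo k))
                                  (∈-map⁺ (λ i → a + suc i) (∈-upTo⁺ d<n∸a))))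
  where
  d<n∸a : d < n ∸ a
  d<n∸a = m+n≤o⇒m≤o∸n (suc d) (subst (_≤ n) (cong suc (+-comm a d)) y≤n)

stuck⇒occupied : ∀ {n k a occ y} → firstFree n occ (naplesCandidates n k a) ≡ nothing →
                 1 ≤ y → y ≤ n → a ≤ y + k → y ∈ occ
stuck⇒occupied {n} {k} {a} {occ} {y} stuck 1≤y y≤n a≤y+k =
  isFree≡false⇒∈ occ y
    (trans (cong (_∧ isFree occ y) (sym (valid-spot 1≤y y≤n)))
           (firstFree≡nothing⇒unavailable stuck (∈-naplesCandidates n k a y≤n a≤y+k)))

-- With b = a ⊔ (k + 1), the spots b − k, …, n are all candidates of the car,
-- which covers both the case a ≤ k (the whole street) and the case a > k.
naples-car-parks : ∀ {n k a} occ → length occ < n → length occ + a ≤ n + k →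
                   firstFree n occ (naplesCandidates n k a) ≢ nothing
naples-car-parks {n} {k} {a} occ occ<n room stuck = n≮n (n + k) (begin-strict
  n + k                   <⟨ n<1+n (n + k) ⟩
  suc n + k               ≡⟨ cong (_+ k) (m∸n+n≡m lo≤1+n) ⟨
  (suc n ∸ lo) + lo + k   ≡⟨ +-assoc (suc n ∸ lo) lo k ⟩
  (suc n ∸ lo) + (lo + k) ≡⟨ cong (_+_ (suc n ∸ lo)) lo+k≡b ⟩
  (suc n ∸ lo) + b        ≤⟨ +-monoˡ-≤ b block⊆occ ⟩
  length occ + b          ≤⟨ room-b ⟩
  n + k                   ∎)
  where
  open ≤-Reasoning
  b : ℕ
  b = a ⊔ suc k
  lo : ℕ
  lo = b ∸ k
  room-b : length occ + b ≤ n + k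
  room-b = subst (_≤ n + k) (sym (+-distribˡ-⊔ (length occ) a (suc k)))
             (⊔-lub room (subst (_≤ n + k) (sym (+-suc (length occ) k))
                                           (+-monoˡ-≤ k occ<n)))
  lo+k≡b : lo + k ≡ b
  lo+k≡b = m∸n+n≡m (<⇒≤ (m≤n⊔m a (suc k)))
  lo≤1+n : lo ≤ suc n
  lo≤1+n = ≤-trans (subst (lo ≤_) (m+n∸n≡m n k)
                           (∸-monoˡ-≤ k (≤-trans (m≤n+m b (length occ)) room-b)))
                   (n≤1+n n)
  block⊆occ : suc n ∸ lo ≤ length occ
  block⊆occ = interval⊆⇒≤length lo (suc n ∸ lo) λ y lo≤y y<end →
    stuck⇒occupied stuck (≤-trans (m<n⇒0<n∸m (m≤n⊔m a (suc k))) lo≤y)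
      (≤-pred (subst (y <_) (m+[n∸m]≡n lo≤1+n) y<end))
      (≤-trans (m≤m⊔n a (suc k)) (subst (_≤ y + k) lo+k≡b (+-monoˡ-≤ k lo≤y)))

Room : ℕ → ℕ → List ℕ → List ℕ → ℕ → Set
Room n k occ rest b = length occ + atLeast b rest + b ≤ suc (n + k)

Room-accept : ∀ n k occ rest {a b} s → b ≤ a →
              Room n k occ (a ∷ rest) b → Room n k (s ∷ occ) rest b
Room-accept n k occ rest {b = b} _ b≤a =
  subst (λ z → z + b ≤ suc (n + k))
        (trans (cong (_+_ (length occ)) (atLeast-accept rest b≤a))
               (+-suc (length occ) (atLeast b rest)))

parkFrom-succeeds : ∀ {n k} occ rest → AllPairs _≥_ rest → length occ + length rest ≤ n →
                    All (Room n k occ rest) rest → is-just (parkFrom n k occ rest) ≡ true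
parkFrom-succeeds occ [] _ _ _ = refl
parkFrom-succeeds {n} {k} occ (a ∷ rest) (a≥rest ∷ descending) fits (room ∷ rooms)
  with firstFree n occ (naplesCandidates n k a) in outcome
... | nothing = ⊥-elim (naples-car-parks occ occ<n room-a outcome)
  where
  occ<n : length occ < n
  occ<n = ≤-trans (s≤s (m≤m+n (length occ) (length rest)))
                  (subst (_≤ n) (+-suc (length occ) (length rest)) fits)
  room-a : length occ + a ≤ n + k
  room-a = ≤-trans (+-monoˡ-≤ a (m≤m+n (length occ) (atLeast a rest)))
                   (≤-pred (Room-accept n k occ rest a ≤-refl room))
... | just s = parkFrom-succeeds (s ∷ occ) rest descending
                 (subst (_≤ n) (+-suc (length occ) (length rest)) fits)
                 (All.zipWith (uncurry (Room-accept n k occ rest s)) (a≥rest , rooms))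

toList-All : ∀ {m} {P : ℕ → Set} (β : Vec ℕ m) → (∀ i → P (lookup β i)) → All P (toList β)
toList-All β p = toList⁺ (lookup⁻ p)

toList-descending : ∀ {m} (β : Vec ℕ m) →
                    (∀ i j → i Fin.≤ j → lookup β j ≤ lookup β i) → AllPairs _≥_ (toList β)
toList-descending Vec.[]       _    = []
toList-descending (x Vec.∷ β) desc =
  toList-All β (λ j → desc Fin.zero (Fin.suc j) z≤n)
  ∷ toList-descending β (λ i j i≤j → desc (Fin.suc i) (Fin.suc j) (s≤s i≤j))

[+m]-[+n]≤+o⇒m≤n+o : ∀ m n o → + m ℤ.- + n ℤ.≤ + o → m ≤ n + o
[+m]-[+n]≤+o⇒m≤n+o m n o h =
  subst (m ≤_) (+-comm o n)
        (ℤP.drop‿+≤+ (subst (ℤ._≤ + (o + n)) cancel (ℤP.+-monoˡ-≤ (+ n) h)))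
  where
  cancel : + m ℤ.- + n ℤ.+ + n ≡ + m
  cancel = trans (ℤP.+-assoc (+ m) (ℤ.- + n) (+ n))
                 (trans (cong (ℤ._+_ (+ m)) (ℤP.+-inverseˡ (+ n))) (ℤP.+-identityʳ (+ m)))

u≤k⇒room : ∀ {n k j} (α : Vec ℕ n) → (∀ i → lookup α i ≤ n) → j ≤ n → u n α j ℤ.≤ + k →
           atLeast j (toList α) + j ≤ suc (n + k)
u≤k⇒room {n} {k} {j} α α≤n j≤n u≤k = begin
  atLeast j (toList α) + j ≤⟨ +-monoˡ-≤ j (≤-trans count≤sum sum≤m+k) ⟩
  m + k + j               ≡⟨ cong (_+ j) (+-∸-comm k j≤n+1) ⟨
  n + 1 + k ∸ j + j       ≡⟨ m∸n+n≡m (≤-trans j≤n+1 (m≤m+n (n + 1) k)) ⟩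
  n + 1 + k               ≡⟨ +-assoc n 1 k ⟩
  n + suc k               ≡⟨ +-suc n k ⟩
  suc (n + k)             ∎
  where
  open ≤-Reasoning
  m : ℕ
  m = n + 1 ∸ j
  j≤n+1 : j ≤ n + 1
  j≤n+1 = ≤-trans j≤n (m≤m+n n 1)
  count≤sum : atLeast j (toList α) ≤ sum (map (λ t → mult α (j + t)) (upTo m))
  count≤sum = atLeast≤sum-multiplicity j m (toList α)
    (toList-All α λ i → subst (lookup α i <_) (sym (m+[n∸m]≡n j≤n+1))
                              (≤-<-trans (α≤n i) (m<m+n n z<s)))
  sum≤m+k : sum (map (λ t → mult α (j + t)) (upTo m)) ≤ m + k
  sum≤m+k = [+m]-[+n]≤+o⇒m≤n+o _ m k u≤k

mainTheorem2 : (n : ℕ) (α : Vec ℕ n) → InPP n α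
    → (∀ (i j : Fin n) → i Data.Fin.≤ j → lookup α j ≤ lookup α i)
    → (k : ℕ) → 1 ≤ k
    → (∀ (j : ℕ) → 1 ≤ j → j ≤ n → u n α j ℤ.≤ + k)
    → IsNaplesPF n k α
mainTheorem2 n α inPP descending k _ u≤k =
  parkFrom-succeeds [] (toList α) (toList-descending α descending)
    (≤-reflexive (length-toList α)) (toList-All α room)
  where
  α≤n : ∀ i → lookup α i ≤ n
  α≤n i = proj₂ (inPP i)
  room : ∀ i → Room n k [] (toList α) (lookup α i)
  room i = u≤k⇒room α α≤n (α≤n i) (u≤k (lookup α i) (proj₁ (inPP i)) (α≤n i))
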